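{- Let $G$ be an ordered graph. Then $G$ is an ordered core if and only if there is no ordered homomorphism from $G$ to a proper ordered subgraph of $G$. Moreover, every ordered graph is homomorphically equivalent to an ordered core, and this ordered core is unique up to isomorphism.
   Context: An ordered graph is a finite graph together with a total order $\le$ on its vertex set. An ordered subgraph of $G$ is a subgraph of $G$ equipped with the restriction of the order of $G$. For ordered graphs $G,H$, an ordered homomorphism $f:G\to H$ is a map $f:V(G)\to V(H)$ such that $uv\in E(G)$ implies $f(u)f(v)\in E(H)$, and $u\le v$ implies $f(u)\le f(v)$. If $H$ is an ordered subgraph of $G$, an ordered retraction of $G$ to $H$ is an ordered homomorphism $f:G\to H$ with $f(v)=v$ for all $v\in V(H)$. An ordered core is an ordered graph that has no ordered retraction to a proper ordered subgraph. Two ordered graphs $G,H$ are homomorphically equivalent if there exist ordered homomorphisms $G\to H$ and $H\to G$. -}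

module Defs where

open import Data.Nat using (ℕ)
open import Data.Fin using (Fin; _≤_)
open import Data.Bool using (Bool; true; false)
open import Data.Product using (Σ; ∃; _×_; _,_)
open import Data.Sum using (_⊎_)
open import Relation.Binary.PropositionalEquality using (_≡_)
open import Relation.Nullary using (¬_)

-- An ordered graph: a finite simple graph on the vertex set Fin n, ordered by
-- the usual order of Fin n (every finite totally ordered set is order-isomorphic
-- to some Fin n with its standard order).
record OGraph : Set where
  field
    size   : ℕ
    E      : Fin size → Fin size → Bool
    E-sym  : ∀ u v → E u v ≡ E v u
    E-irr  : ∀ v → E v v ≡ false
open OGraph public

V : OGraph → Set
V G = Fin (size G)

record OHom (G H : OGraph) : Set where
  field
    map      : V G → V H
    map-edge : ∀ u v → E G u v ≡ true → E H (map u) (map v) ≡ true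
    map-mono : ∀ {u v} → u ≤ v → map u ≤ map v
open OHom public

HomEquiv : OGraph → OGraph → Set
HomEquiv G H = OHom G H × OHom H G

record OIso (G H : OGraph) : Set where
  field
    to      : OHom G H
    from    : OHom H G
    from∘to : ∀ v → map from (map to v) ≡ v
    to∘from : ∀ v → map to (map from v) ≡ v
open OIso public

-- An ordered subgraph of G: a vertex subset Vs and an edge subset Fs ⊆ E(G)
-- whose edges have both ends in Vs; it carries the restricted order of G.
record OSub (G : OGraph) : Set where
  field
    Vs     : V G → Bool
    Fs     : V G → V G → Bool
    Fs-sym : ∀ u v → Fs u v ≡ Fs v u
    Fs⊆E   : ∀ u v → Fs u v ≡ true → E G u v ≡ true
    Fs-end : ∀ u v → Fs u v ≡ true → Vs u ≡ true
open OSub public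

Proper : {G : OGraph} → OSub G → Set
Proper {G} H = (∃ λ v → Vs H v ≡ false)
             ⊎ (∃ λ u → ∃ λ v → E G u v ≡ true × Fs H u v ≡ false)

record OHomSub (G : OGraph) (H : OSub G) : Set where
  field
    smap      : V G → V G
    smap-in   : ∀ v → Vs H (smap v) ≡ true
    smap-edge : ∀ u v → E G u v ≡ true → Fs H (smap u) (smap v) ≡ true
    smap-mono : ∀ {u v} → u ≤ v → smap u ≤ smap v
open OHomSub public

record ORetract (G : OGraph) (H : OSub G) : Set where
  field
    hom   : OHomSub G H
    fixes : ∀ v → Vs H v ≡ true → smap hom v ≡ v
open ORetract public

IsOCore : OGraph → Set
IsOCore G = (H : OSub G) → Proper H → ¬ ORetract G H

-- Every orbit of a monotone self-map f of a finite chain is a monotone sequence, so it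
-- reaches a fixed point of f within n steps; the corresponding iterate of an ordered
-- endomorphism f is therefore an ordered retraction onto the fixed points of f. Hence G
-- is a core iff every ordered endomorphism of G is the identity, while an ordered
-- homomorphism into a proper subgraph is an endomorphism that cannot be the identity.
-- A core is reached by deleting, as long as some endomorphism f moves a vertex w, that
-- vertex: the stabilised iterate of f avoids w, so G maps into G − w and back. Two
-- homomorphically equivalent cores are isomorphic, since both composites are
-- endomorphisms of cores and hence identities.
module Submission where

open import Defs
open import Data.Product using (Σ; _×_)
open import Relation.Nullary using (¬_)
open import Function.Bundles using (_⇔_)

open import Data.Bool using (Bool; true; _∧_)
open import Data.Bool.Properties using (∧-comm; ∧-conicalˡ; ∧-conicalʳ; not-¬; T-≡; T-not-≡)
  renaming (_≟_ to _≟ᴮ_)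
open import Data.Fin using (Fin; zero; suc; toℕ; punchIn; punchOut; _≤_; _≟_)
open import Data.Fin.Properties
  using (≤-total; ≤∧≢⇒<; toℕ<n; toℕ≤n; _≤?_; any?; all?;
         punchIn-mono-≤; punchOut-mono-≤; punchIn-punchOut)
open import Data.Nat as ℕ using (ℕ; zero; suc; _+_; _∸_)
import Data.Nat.Properties as ℕ
open import Data.Nat.GeneralisedArithmetic using (iterate)
open import Data.Product using (∃; _,_; swap)
open import Data.Sum using (_⊎_; inj₁; inj₂)
open import Data.Vec.Functional using (_∷_)
open import Function using (_∘_; flip)
open import Function.Bundles using (Equivalence; mk⇔)
open import Relation.Binary using (Rel; _Preserves_⟶_; DecidableEquality)
open import Relation.Binary.PropositionalEquality
  using (_≡_; _≢_; refl; sym; trans; cong; cong₂; subst; subst₂; _≗_)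
open import Relation.Nullary using (Dec; yes; no; ¬?; _×-dec_; _→-dec_; contradiction)
open import Relation.Nullary.Decidable
  using (⌊_⌋; map′; toWitness; fromWitness; fromWitnessFalse; decidable-stable)
open import Relation.Unary using (Decidable)

module _ {A : Set} (f : A → A) where

  iterate-preserves : ∀ {ℓ} {R : Rel A ℓ} → f Preserves R ⟶ R →
                      ∀ k {x y} → R x y → R (iterate f x k) (iterate f y k)
  iterate-preserves f-pres zero    xRy = xRy
  iterate-preserves {R = R} f-pres (suc k) xRy = iterate-preserves {R = R} f-pres k (f-pres xRy)

  iterate-fixed : ∀ {x} → f x ≡ x → ∀ k → iterate f x k ≡ x
  iterate-fixed fx≡x zero    = refl
  iterate-fixed fx≡x (suc k) = trans (cong (λ y → iterate f y k) fx≡x) (iterate-fixed fx≡x k)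

module _ {A : Set} (_≟A_ : DecidableEquality A) (f : A → A)
         {ℓ} {_R_ : Rel A ℓ} (f-mono : f Preserves _R_ ⟶ _R_)
         (rank : A → ℕ) (rank-strict : ∀ {a b} → a R b → a ≢ b → rank a ℕ.< rank b)
         where

  orbit-climbs : ∀ k x → x R f x →
                 f (iterate f x k) ≡ iterate f x k ⊎ k + rank x ℕ.≤ rank (iterate f x k)
  orbit-climbs zero    x _    = inj₂ ℕ.≤-refl
  orbit-climbs (suc k) x xRfx with f x ≟A x
  ... | yes fx≡x = inj₁ (subst (λ y → f y ≡ y) (sym (iterate-fixed f fx≡x (suc k))) fx≡x)
  ... | no  fx≢x with orbit-climbs k (f x) (f-mono xRfx)
  ...   | inj₁ fixed   = inj₁ fixed
  ...   | inj₂ climbed = inj₂ (subst (ℕ._≤ rank (iterate f (f x) k)) (ℕ.+-suc k (rank x))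
                                 (ℕ.≤-trans (ℕ.+-monoʳ-≤ k (rank-strict xRfx (fx≢x ∘ sym))) climbed))

  orbit-stabilises : ∀ {b} → (∀ a → rank a ℕ.≤ b) →
                     ∀ x → x R f x → f (iterate f x (suc b)) ≡ iterate f x (suc b)
  orbit-stabilises {b} rank≤b x xRfx with orbit-climbs (suc b) x xRfx
  ... | inj₁ fixed   = fixed
  ... | inj₂ climbed = contradiction
        (ℕ.≤-trans (ℕ.m≤m+n (suc b) (rank x)) (ℕ.≤-trans climbed (rank≤b _))) (ℕ.n≮n b)

-- The orbit climbs upwards or downwards according to how x compares with f x; it is
-- ranked by the position of a point, respectively by its distance from the top.
monotone-orbit-stabilises : ∀ {n} (f : Fin n → Fin n) → f Preserves _≤_ ⟶ _≤_ →
                            ∀ x → f (iterate f x (suc n)) ≡ iterate f x (suc n)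
monotone-orbit-stabilises {n} f f-mono x with ≤-total x (f x)
... | inj₁ x≤fx = orbit-stabilises _≟_ f {_R_ = _≤_} f-mono
                    toℕ ≤∧≢⇒< (ℕ.<⇒≤ ∘ toℕ<n) x x≤fx
... | inj₂ fx≤x = orbit-stabilises _≟_ f {_R_ = flip _≤_} f-mono
                    (λ a → n ∸ toℕ a) (λ b≤a a≢b → ℕ.∸-monoʳ-< (≤∧≢⇒< b≤a (a≢b ∘ sym)) (toℕ≤n _))
                    (λ a → ℕ.m∸n≤m n (toℕ a)) x fx≤x

idᴴ : ∀ {G} → OHom G G
idᴴ = record { map = λ v → v ; map-edge = λ _ _ uv∈E → uv∈E ; map-mono = λ u≤v → u≤v }

_∘ᴴ_ : ∀ {G H K} → OHom H K → OHom G H → OHom G K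
g ∘ᴴ f = record
  { map      = map g ∘ map f
  ; map-edge = λ u v uv∈E → map-edge g _ _ (map-edge f u v uv∈E)
  ; map-mono = map-mono g ∘ map-mono f
  }

_^ᴴ_ : ∀ {G} → OHom G G → ℕ → OHom G G
_^ᴴ_ {G} f k = record
  { map      = λ v → iterate (map f) v k
  ; map-edge = λ _ _ → iterate-preserves (map f) {R = λ u v → E G u v ≡ true} (map-edge f _ _) k
  ; map-mono = iterate-preserves (map f) {R = _≤_} (map-mono f) k
  }

-- Enough iterations for every orbit of f to reach a fixed point (monotone-orbit-stabilises).
_^ω : ∀ {G} → OHom G G → OHom G G
_^ω {G} f = f ^ᴴ suc (size G)

^ω-fixed : ∀ {G} (f : OHom G G) v → map f (map (f ^ω) v) ≡ map (f ^ω) v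
^ω-fixed f = monotone-orbit-stabilises (map f) (map-mono f)

^ω-avoids-moved : ∀ {G} (f : OHom G G) {w} → map f w ≢ w → ∀ v → w ≢ map (f ^ω) v
^ω-avoids-moved f fw≢w v w≡f^ωv = fw≢w (subst (λ x → map f x ≡ x) (sym w≡f^ωv) (^ω-fixed f v))

homEquiv-sym : ∀ {G H} → HomEquiv G H → HomEquiv H G
homEquiv-sym = swap

homEquiv-trans : ∀ {G H K} → HomEquiv G H → HomEquiv H K → HomEquiv G K
homEquiv-trans (f , f′) (g , g′) = g ∘ᴴ f , f′ ∘ᴴ g′

induced : (G : OGraph) → (V G → Bool) → OSub G
induced G S = record
  { Vs     = S
  ; Fs     = λ u v → E G u v ∧ (S u ∧ S v)
  ; Fs-sym = λ u v → cong₂ _∧_ (E-sym G u v) (∧-comm (S u) (S v))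
  ; Fs⊆E   = λ u v → ∧-conicalˡ (E G u v) _
  ; Fs-end = λ u v uv∈F → ∧-conicalˡ (S u) (S v) (∧-conicalʳ (E G u v) _ uv∈F)
  }

fixedPoints : ∀ {G} → OHom G G → OSub G
fixedPoints {G} f = induced G (λ v → ⌊ map f v ≟ v ⌋)

fixedPoints-proper : ∀ {G} (f : OHom G G) {w} → map f w ≢ w → Proper (fixedPoints f)
fixedPoints-proper f {w} fw≢w = inj₁ (w , Equivalence.to T-not-≡ (fromWitnessFalse fw≢w))

retraction-onto-fixedPoints : ∀ {G} (f : OHom G G) → ORetract G (fixedPoints f)
retraction-onto-fixedPoints {G} f = record
  { hom = record
    { smap      = map (f ^ω)
    ; smap-in   = lands-in-fixedPoints
    ; smap-edge = λ u v uv∈E → cong₂ _∧_ (map-edge (f ^ω) u v uv∈E)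
                                        (cong₂ _∧_ (lands-in-fixedPoints u) (lands-in-fixedPoints v))
    ; smap-mono = map-mono (f ^ω)
    }
  ; fixes = λ v v∈F → iterate-fixed (map f) (toWitness (Equivalence.from T-≡ v∈F)) (suc (size G))
  }
  where
  lands-in-fixedPoints : ∀ v → ⌊ map f (map (f ^ω) v) ≟ map (f ^ω) v ⌋ ≡ true
  lands-in-fixedPoints v = Equivalence.to T-≡ (fromWitness (^ω-fixed f v))

Rigid : OGraph → Set
Rigid G = (f : OHom G G) → ∀ v → map f v ≡ v

core⇒rigid : ∀ {G} → IsOCore G → Rigid G
core⇒rigid core f v = decidable-stable (map f v ≟ v) λ fv≢v →
  core (fixedPoints f) (fixedPoints-proper f fv≢v) (retraction-onto-fixedPoints f)

endoOfSub : ∀ {G} {H : OSub G} → OHomSub G H → OHom G G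
endoOfSub {H = H} h = record
  { map      = smap h
  ; map-edge = λ u v uv∈E → Fs⊆E H _ _ (smap-edge h u v uv∈E)
  ; map-mono = smap-mono h
  }

rigid⇒noHomToProper : ∀ {G} → Rigid G → (H : OSub G) → Proper H → ¬ OHomSub G H
rigid⇒noHomToProper rigid H proper h = not-proper proper
  where
  h≗id : ∀ v → smap h v ≡ v
  h≗id = rigid (endoOfSub h)

  not-proper : ¬ Proper H
  not-proper (inj₁ (v , v∉H)) =
    not-¬ (subst (λ x → Vs H x ≡ true) (h≗id v) (smap-in h v)) v∉H
  not-proper (inj₂ (u , v , uv∈E , uv∉F)) =
    not-¬ (subst₂ (λ x y → Fs H x y ≡ true) (h≗id u) (h≗id v) (smap-edge h u v uv∈E)) uv∉F

noHomToProper⇒core : ∀ {G} → ((H : OSub G) → Proper H → ¬ OHomSub G H) → IsOCore G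
noHomToProper⇒core noHom H proper retraction = noHom H proper (hom retraction)

rigid⇒core : ∀ {G} → Rigid G → IsOCore G
rigid⇒core = noHomToProper⇒core ∘ rigid⇒noHomToProper

homEquiv-cores-iso : ∀ {K K′} → IsOCore K → IsOCore K′ → HomEquiv K K′ → OIso K K′
homEquiv-cores-iso K-core K′-core (f , g) = record
  { to      = f
  ; from    = g
  ; from∘to = core⇒rigid K-core (g ∘ᴴ f)
  ; to∘from = core⇒rigid K′-core (f ∘ᴴ g)
  }

∃-function? : ∀ n {m} {P : (Fin n → Fin m) → Set} →
              (∀ {f g} → f ≗ g → P f → P g) → Decidable P → Dec (∃ P)
∃-function? zero    P-resp P? = map′ (_ ,_) (λ (f , Pf) → P-resp (λ ()) Pf) (P? (λ ()))
∃-function? (suc n) P-resp P? =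
  map′ (λ (a , f , Pa∷f) → a ∷ f , Pa∷f)
       (λ (f , Pf) → f zero , f ∘ suc , P-resp (λ { zero → refl ; (suc i) → refl }) Pf)
       (any? λ a → ∃-function? n (λ f≗g → P-resp λ { zero → refl ; (suc i) → f≗g i }) (P? ∘ (a ∷_)))

IsOHom : (G H : OGraph) → (V G → V H) → Set
IsOHom G H f = (∀ u v → E G u v ≡ true → E H (f u) (f v) ≡ true) × (∀ u v → u ≤ v → f u ≤ f v)

isOHom? : (G H : OGraph) → Decidable (IsOHom G H)
isOHom? G H f = all? (λ u → all? λ v → (E G u v ≟ᴮ true) →-dec (E H (f u) (f v) ≟ᴮ true))
         ×-dec all? (λ u → all? λ v → (u ≤? v) →-dec (f u ≤? f v))

IsOHom-resp-≗ : ∀ {G H} {f g : V G → V H} → f ≗ g → IsOHom G H f → IsOHom G H g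
IsOHom-resp-≗ {G} {H} f≗g (f-edge , f-mono) =
    (λ u v uv∈E → subst₂ (λ x y → E H x y ≡ true) (f≗g u) (f≗g v) (f-edge u v uv∈E))
  , (λ u v u≤v → subst₂ _≤_ (f≗g u) (f≗g v) (f-mono u v u≤v))

OHom⇒IsOHom : ∀ {G H} (f : OHom G H) → IsOHom G H (map f)
OHom⇒IsOHom f = map-edge f , λ u v → map-mono f {u} {v}

IsOHom⇒OHom : ∀ {G H} {f : V G → V H} → IsOHom G H f → OHom G H
IsOHom⇒OHom {f = f} (f-edge , f-mono) =
  record { map = f ; map-edge = f-edge ; map-mono = λ {u} {v} → f-mono u v }

NontrivialEndo : OGraph → Set
NontrivialEndo G = Σ (OHom G G) λ f → ∃ λ v → map f v ≢ v

nontrivialEndo? : ∀ G → Dec (NontrivialEndo G)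
nontrivialEndo? G =
  map′ (λ (f , f-hom , moved) → IsOHom⇒OHom f-hom , moved)
       (λ (f , moved) → map f , OHom⇒IsOHom f , moved)
       (∃-function? (size G) {P = NontrivialMap}
          (λ f≗g (f-hom , v , fv≢v) → IsOHom-resp-≗ {G} {G} f≗g f-hom , v , fv≢v ∘ trans (f≗g v))
          (λ f → isOHom? G G f ×-dec any? (λ v → ¬? (f v ≟ v))))
  where
  NontrivialMap : (V G → V G) → Set
  NontrivialMap f = IsOHom G G f × ∃ λ v → f v ≢ v

rigid-or-nontrivialEndo : ∀ G → Rigid G ⊎ NontrivialEndo G
rigid-or-nontrivialEndo G with nontrivialEndo? G
... | yes nontrivial = inj₂ nontrivial
... | no  rigid      = inj₁ λ f v → decidable-stable (map f v ≟ v) λ fv≢v → rigid (f , v , fv≢v)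

pullback : (G : OGraph) {n : ℕ} → (Fin n → V G) → OGraph
pullback G {n} ι = record
  { size  = n
  ; E     = λ a b → E G (ι a) (ι b)
  ; E-sym = λ a b → E-sym G (ι a) (ι b)
  ; E-irr = λ a → E-irr G (ι a)
  }

pullback-homEquiv : ∀ {G n} (r : OHom G G) (κ : Fin n → V G) (π : V G → Fin n) →
                    κ Preserves _≤_ ⟶ _≤_ → π Preserves _≤_ ⟶ _≤_ → (∀ v → κ (π v) ≡ map r v) →
                    HomEquiv G (pullback G κ)
pullback-homEquiv {G} r κ π κ-mono π-mono κπ≡r =
    record { map      = π
           ; map-edge = λ u v uv∈E → subst₂ (λ x y → E G x y ≡ true)
                                      (sym (κπ≡r u)) (sym (κπ≡r v)) (map-edge r u v uv∈E)
           ; map-mono = π-mono }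
  , record { map = κ ; map-edge = λ _ _ ab∈E → ab∈E ; map-mono = κ-mono }

HasCore : OGraph → Set
HasCore G = Σ OGraph λ K → IsOCore K × HomEquiv G K

-- Induction over pullbacks makes the number of vertices a variable, so that
-- deleting the vertex w (pulling back along punchIn w) is structural recursion.
pullback-hasCore : ∀ {G} n (ι : Fin n → V G) → HasCore (pullback G ι)
pullback-hasCore zero    ι = _ , rigid⇒core (λ f ()) , idᴴ , idᴴ
pullback-hasCore {G} (suc n) ι with rigid-or-nontrivialEndo (pullback G ι)
... | inj₁ rigid            = _ , rigid⇒core rigid , idᴴ , idᴴ
... | inj₂ (f , w , fw≢w) =
  let K , K-core , deleted≈K = pullback-hasCore {G} n (ι ∘ punchIn w)
      w≢f^ω = ^ω-avoids-moved f fw≢w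
  in K , K-core , homEquiv-trans
       (pullback-homEquiv (f ^ω) (punchIn w) (λ v → punchOut (w≢f^ω v))
          (punchIn-mono-≤ w _ _) (punchOut-mono-≤ (w≢f^ω _) (w≢f^ω _) ∘ map-mono (f ^ω))
          (punchIn-punchOut ∘ w≢f^ω))
       deleted≈K

-- pullback G (λ v → v) is G itself, by η for records and functions.
hasCore : ∀ G → HasCore G
hasCore G = pullback-hasCore (size G) (λ v → v)

theorem1 : ((G : OGraph) → IsOCore G ⇔ ((H : OSub G) → Proper H → ¬ OHomSub G H))
    × ((G : OGraph) → Σ OGraph (λ K → IsOCore K × HomEquiv G K
        × ((K′ : OGraph) → IsOCore K′ → HomEquiv G K′ → OIso K K′)))
theorem1 =
    (λ G → mk⇔ (rigid⇒noHomToProper ∘ core⇒rigid) noHomToProper⇒core)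
  , λ G → let K , K-core , G≈K = hasCore G in
      K , K-core , G≈K , λ K′ K′-core G≈K′ →
        homEquiv-cores-iso K-core K′-core (homEquiv-trans (homEquiv-sym G≈K) G≈K′)
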